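{- Let $G$ be a finite connected graph and $d$ a positive integer such that (1) $G$ contains no subgraph isomorphic to the complete bipartite graph $K_{d,d+1}$, and (2) a set of $d$ cops has a lonely winning strategy in the (classical) game of Cops and Robbers played on $G$. Then $c_H(G)\le d$.
   Context: In the classical game of Cops and Robbers the robber is always visible; cops choose starting vertices, then the robber does, and then in each round every cop moves to an adjacent vertex or stays, then the robber moves to an adjacent vertex or stays; cops win by occupying the robber's vertex. A strategy of a set of cops is lonely if, throughout its execution, no two cops ever occupy the same vertex at the end of a round. Hyperopic Cops and Robbers is the same game except that the robber is invisible to the cops exactly when the robber's vertex is adjacent to the vertex of every cop (a robber on the same vertex as a cop is visible); otherwise the cops see the robber's position; the robber always sees the cops, and the cops must guarantee capture with certainty (no chance allowed). The hyperopic cop number $c_H(G)$ is the minimum number of cops having a winning strategy in Hyperopic Cops and Robbers on $G$. -}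

module Defs where

open import Data.Nat using (ℕ; zero; suc; _<_; _≤_)
open import Data.Fin using (Fin)
open import Data.Fin.Properties using (all?)
open import Data.Bool using (Bool; true; false; if_then_else_)
import Data.Bool.Properties as BoolP
open import Data.Maybe using (Maybe; just; nothing)
open import Data.List using (List; []; _∷_)
open import Data.Product using (Σ; ∃; _×_; _,_; proj₁; proj₂)
open import Data.Sum using (_⊎_; inj₁; inj₂)
open import Relation.Nullary using (¬_; does)
open import Relation.Binary.PropositionalEquality using (_≡_)
open import Function.Definitions using (Injective)

record Graph : Set where
  field
    n       : ℕ
    adj     : Fin n → Fin n → Bool
    sym     : ∀ u v → adj u v ≡ adj v u
    irrefl  : ∀ u → adj u u ≡ false

module _ (G : Graph) where
  open Graph G

  Vertex : Set
  Vertex = Fin n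

  Adj : Vertex → Vertex → Set
  Adj u v = adj u v ≡ true

  Move : Vertex → Vertex → Set
  Move u v = v ≡ u ⊎ Adj u v

  data Reach : Vertex → Vertex → Set where
    here  : ∀ {u} → Reach u u
    there : ∀ {u v w} → Adj u v → Reach v w → Reach u w

  Connected : Set
  Connected = ∀ u v → Reach u v

  -- G contains a (not necessarily induced) subgraph isomorphic to K_{a,b}
  ContainsKab : ℕ → ℕ → Set
  ContainsKab a b =
    Σ (Fin a ⊎ Fin b → Vertex) λ f →
      Injective _≡_ _≡_ f × (∀ i j → Adj (f (inj₁ i)) (f (inj₂ j)))

  Config : ℕ → Set
  Config k = Fin k → Vertex

  -- an event seen by the cops: their current configuration together
  -- with their observation of the robber (nothing = invisible)
  Event : ℕ → Set
  Event k = Config k × Maybe Vertex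

  seeClassical : ∀ {k} → Config k → Vertex → Maybe Vertex
  seeClassical c r = just r

  seeHyperopic : ∀ {k} → Config k → Vertex → Maybe Vertex
  seeHyperopic c r =
    if does (all? (λ i → adj (c i) r BoolP.≟ true)) then nothing else just r

  -- deterministic cop strategy: initial placement, and next configuration
  -- as a function of the full observation history (most recent first)
  record Strategy (k : ℕ) : Set where
    field
      start : Config k
      move  : List (Event k) → Config k

  RobberWalk : (ℕ → Vertex) → Set
  RobberWalk r = ∀ t → Move (r t) (r (suc t))

  module Play {k : ℕ}
              (see : Config k → Vertex → Maybe Vertex)
              (σ : Strategy k) (r : ℕ → Vertex) where
    open Strategy σ

    -- run t = (c_t , history) where c_t is the cops' configuration in
    -- round t (after their move), r t the robber's position after its move
    -- in round t, and history lists all observations made so far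
    -- (after each cop move and after each robber move).
    run : ℕ → Config k × List (Event k)
    run zero = start , (start , see start (r zero)) ∷ []
    run (suc t) =
      let h  = proj₂ (run t)
          c′ = move h
      in c′ , (c′ , see c′ (r (suc t))) ∷ (c′ , see c′ (r t)) ∷ h

    cops : ℕ → Config k
    cops t = proj₁ (run t)

    LegalStep : ℕ → Set
    LegalStep t = ∀ i → Move (cops t i) (cops (suc t) i)

    Lonely : ℕ → Set
    Lonely t = Injective _≡_ _≡_ (cops t)

    -- capture at round T: either the robber ends round T on a cop, or in
    -- round T+1 a cop moves onto the robber's vertex r T.
    -- All cop moves up to the capture must be legal.
    CaptureAt : ℕ → Set
    CaptureAt T =
      (∀ t → t < T → LegalStep t) ×
      ((∃ λ i → cops T i ≡ r T) ⊎
       (LegalStep T × ∃ λ i → cops (suc T) i ≡ r T))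

    LonelyCaptureAt : ℕ → Set
    LonelyCaptureAt T =
      (∀ t → t < T → LegalStep t) × (∀ t → t ≤ T → Lonely t) ×
      ((∃ λ i → cops T i ≡ r T) ⊎
       (LegalStep T × Lonely (suc T) × ∃ λ i → cops (suc T) i ≡ r T))

  Winning : ∀ {k} → (Config k → Vertex → Maybe Vertex) → Strategy k → Set
  Winning see σ = ∀ r → RobberWalk r → ∃ λ T → Play.CaptureAt see σ r T

  LonelyWinning : ∀ {k} → (Config k → Vertex → Maybe Vertex) → Strategy k → Set
  LonelyWinning see σ = ∀ r → RobberWalk r → ∃ λ T → Play.LonelyCaptureAt see σ r T

  HasLonelyClassicalWin : ℕ → Set
  HasLonelyClassicalWin d = Σ (Strategy d) λ σ → LonelyWinning seeClassical σ

  HyperopicWin : ℕ → Set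
  HyperopicWin k = Σ (Strategy k) λ σ → Winning seeHyperopic σ

  -- c_H(G) ≤ d  (c_H is the minimum k with HyperopicWin k)
  HyperopicCopNumber≤ : ℕ → Set
  HyperopicCopNumber≤ d = ∃ λ k → k ≤ d × HyperopicWin k

-- The d cops follow the classical lonely strategy as long as they see the
-- robber, feeding it the robber's position from the previous event whenever
-- it hides right after a cop move (it has not moved since).  If the robber
-- hides right after its own move, it stands on a common neighbour of all d
-- cops.  The cops occupy distinct vertices, so d + 1 common neighbours would
-- form a K_{d,d+1}; hence there are at most d of them, and in one move the
-- cops can occupy them all, catching the robber.

module Submission where

open import Defs
open import Data.Nat using (ℕ; zero; suc; _<_; _≤_; _≥_; s≤s; _≤?_)
open import Data.Nat.Properties
  using (≤-refl; <-≤-trans; ≤-pred; ≰⇒>; m≤n⇒m≤1+n; n≤1+n; m<1+n⇒m<n∨m≡n)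
open import Data.Fin using (Fin; zero; suc; inject≤)
open import Data.Fin.Properties using (all?; inject≤-injective)
open import Data.Bool using (true; if_then_else_)
import Data.Bool.Properties as Bool
open import Data.Maybe using (Maybe; just; nothing)
open import Data.List using (List; []; _∷_; length; lookup; filter; allFin)
open import Data.List.Relation.Unary.All as All using (All; []; _∷_)
open import Data.List.Relation.Unary.All.Properties using (all-filter)
open import Data.List.Relation.Unary.Any using (here; there)
open import Data.List.Relation.Unary.AllPairs using (_∷_)
open import Data.List.Relation.Unary.Unique.Propositional using (Unique)
open import Data.List.Relation.Unary.Unique.Propositional.Properties using (allFin⁺; filter⁺)
open import Data.List.Membership.Propositional using (_∈_)
open import Data.List.Membership.Propositional.Properties using (∈-filter⁺; ∈-allFin; ∈-lookup)
open import Data.Product using (∃; _×_; _,_; proj₁; proj₂)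
open import Data.Sum using (_⊎_; inj₁; inj₂; [_,_]; map₁; swap)
open import Data.Empty using (⊥-elim)
open import Function using (_∘_)
open import Function.Definitions using (Injective)
open import Relation.Nullary using (¬_; Dec; yes; no; does)
open import Relation.Unary using (Decidable)
open import Relation.Binary.PropositionalEquality
  using (_≡_; _≢_; refl; sym; trans; cong; cong₂; cong-app; subst; subst₂; module ≡-Reasoning)
open ≡-Reasoning

lookup-injective : ∀ {A : Set} {xs : List A} → Unique xs → Injective _≡_ _≡_ (lookup xs)
lookup-injective (_ ∷ _)   {zero}  {zero}  _ = refl
lookup-injective (x∉ ∷ _)  {zero}  {suc j} e = ⊥-elim (All.lookup x∉ (∈-lookup j) e)
lookup-injective (x∉ ∷ _)  {suc i} {zero}  e = ⊥-elim (All.lookup x∉ (∈-lookup i) (sym e))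
lookup-injective (_ ∷ xs!) {suc i} {suc j} e = cong suc (lookup-injective xs! e)

if-does-cases : ∀ {A P : Set} {x y : A} (p? : Dec P) →
  ((if does p? then x else y) ≡ x × P) ⊎ (if does p? then x else y) ≡ y
if-does-cases (yes p) = inj₁ (refl , p)
if-does-cases (no _)  = inj₂ refl

all-before-or-first-failure : {P Q : ℕ → Set} → (∀ t → P t ⊎ Q t) → ∀ T →
  (∀ t → t < T → P t) ⊎ ∃ λ t₀ → t₀ < T × (∀ t → t < t₀ → P t) × Q t₀
all-before-or-first-failure P⊎Q zero = inj₁ λ _ ()
all-before-or-first-failure P⊎Q (suc T) with all-before-or-first-failure P⊎Q T
... | inj₂ (t₀ , t₀<T , before , q) = inj₂ (t₀ , m≤n⇒m≤1+n t₀<T , before , q)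
... | inj₁ before with P⊎Q T
...   | inj₁ p = inj₁ λ t t<1+T → [ before t , (λ { refl → p }) ] (m<1+n⇒m<n∨m≡n t<1+T)
...   | inj₂ q = inj₂ (T , ≤-refl , before , q)

module _ (G : Graph) where
  open Graph G using (n; adj; irrefl)

  Adj⇒≢ : ∀ {u v} → Adj G u v → u ≢ v
  Adj⇒≢ {u} uv refl with trans (sym uv) (irrefl u)
  ... | ()

  bipartite⇒ContainsKab : ∀ {a b} (f : Fin a → Vertex G) (g : Fin b → Vertex G) →
    Injective _≡_ _≡_ f → Injective _≡_ _≡_ g → (∀ i j → Adj G (f i) (g j)) →
    ContainsKab G a b
  bipartite⇒ContainsKab f g f-inj g-inj f~g = [ f , g ] , injective , f~g
    where
      injective : Injective _≡_ _≡_ [ f , g ]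
      injective {inj₁ i} {inj₁ i′} e = cong inj₁ (f-inj e)
      injective {inj₁ i} {inj₂ j}  e = ⊥-elim (Adj⇒≢ (f~g i j) e)
      injective {inj₂ j} {inj₁ i}  e = ⊥-elim (Adj⇒≢ (f~g i j) (sym e))
      injective {inj₂ j} {inj₂ j′} e = cong inj₂ (g-inj e)

  CommonNeighbour : ∀ {k} → Config G k → Vertex G → Set
  CommonNeighbour c v = ∀ i → Adj G (c i) v

  commonNeighbour? : ∀ {k} (c : Config G k) → Decidable (CommonNeighbour c)
  commonNeighbour? c v = all? (λ i → adj (c i) v Bool.≟ true)

  commonNeighbours : ∀ {k} → Config G k → List (Vertex G)
  commonNeighbours c = filter (commonNeighbour? c) (allFin n)

  few-common-neighbours : ∀ {k m} {c : Config G k} {vs : List (Vertex G)} →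
    Injective _≡_ _≡_ c → ¬ ContainsKab G k (suc m) →
    Unique vs → All (CommonNeighbour c) vs → length vs ≤ m
  few-common-neighbours {m = m} {c} {vs} c-inj noK vs! common with length vs ≤? m
  ... | yes vs≤m = vs≤m
  ... | no vs≰m = ⊥-elim (noK (bipartite⇒ContainsKab c g c-inj g-inj (λ i j → g-common j i)))
    where
      m<vs = ≰⇒> vs≰m
      g : Fin (suc m) → Vertex G
      g j = lookup vs (inject≤ j m<vs)
      g-inj : Injective _≡_ _≡_ g
      g-inj e = inject≤-injective m<vs m<vs _ _ (lookup-injective vs! e)
      g-common : ∀ j → CommonNeighbour c (g j)
      g-common j = All.lookup common (∈-lookup (inject≤ j m<vs))

  occupy : ∀ {k} → List (Vertex G) → Config G k → Config G k
  occupy []       c i       = c i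
  occupy (v ∷ vs) c zero    = v
  occupy (v ∷ vs) c (suc i) = occupy vs (c ∘ suc) i

  occupy-legal : ∀ {k} {c : Config G k} {vs} → All (CommonNeighbour c) vs →
    ∀ i → Move G (c i) (occupy vs c i)
  occupy-legal []             i       = inj₁ refl
  occupy-legal (v-common ∷ _) zero    = inj₂ (v-common zero)
  occupy-legal (_ ∷ common)   (suc i) = occupy-legal (All.map (_∘ suc) common) i

  occupy-covers : ∀ {k} {c : Config G k} {v vs} → length vs ≤ k → v ∈ vs →
    ∃ λ i → occupy vs c i ≡ v
  occupy-covers (s≤s _)    (here refl)  = zero , refl
  occupy-covers (s≤s vs≤k) (there v∈vs) with occupy-covers vs≤k v∈vs
  ... | i , e = suc i , e

  surround : ∀ {k} → Config G k → Config G k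
  surround c = occupy (commonNeighbours c) c

  surround-legal : ∀ {k} (c : Config G k) i → Move G (c i) (surround c i)
  surround-legal c = occupy-legal (all-filter (commonNeighbour? c) (allFin n))

  surround-captures : ∀ {k} {c : Config G k} {v} →
    Injective _≡_ _≡_ c → ¬ ContainsKab G k (suc k) → CommonNeighbour c v →
    ∃ λ i → surround c i ≡ v
  surround-captures {c = c} {v} c-inj noK v-common =
    occupy-covers few (∈-filter⁺ (commonNeighbour? c) (∈-allFin v) v-common)
    where
      few = few-common-neighbours c-inj noK
              (filter⁺ (commonNeighbour? c) (allFin⁺ n))
              (all-filter (commonNeighbour? c) (allFin n))

  seeHyperopic-cases : ∀ {k} (c : Config G k) v →
    (seeHyperopic G c v ≡ nothing × CommonNeighbour c v) ⊎ seeHyperopic G c v ≡ just v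
  seeHyperopic-cases c v = if-does-cases (commonNeighbour? c v)

module Simulation (G : Graph) {d : ℕ} (σ : Strategy G d) where
  open Strategy σ

  observation : List (Event G d) → Maybe (Vertex G)
  observation []            = nothing
  observation ((_ , o) ∷ _) = o

  -- Until the strategy below stops simulating σ, the robber can only be
  -- invisible right after a cop move, so it still stands where the
  -- previous event saw it.
  toClassical : List (Event G d) → List (Event G d)
  toClassical []                  = []
  toClassical ((c , just v) ∷ h)  = (c , just v) ∷ toClassical h
  toClassical ((c , nothing) ∷ h) = (c , observation h) ∷ toClassical h

  hyperopicMove : List (Event G d) → Config G d
  hyperopicMove []                  = start
  hyperopicMove ((c , nothing) ∷ _) = surround G c
  hyperopicMove h@((_ , just _) ∷ _) = move (toClassical h)

  hyperopicStrategy : Strategy G d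
  hyperopicStrategy = record { start = start ; move = hyperopicMove }

  toClassical-seen : ∀ {c o v h} → o ≡ just v →
    toClassical ((c , o) ∷ h) ≡ (c , just v) ∷ toClassical h
  toClassical-seen refl = refl

  toClassical-unmoved : ∀ {c o v h} → o ≡ nothing ⊎ o ≡ just v → observation h ≡ just v →
    toClassical ((c , o) ∷ h) ≡ (c , just v) ∷ toClassical h
  toClassical-unmoved {c} {h = h} (inj₁ refl) seen = cong (λ o → (c , o) ∷ toClassical h) seen
  toClassical-unmoved             (inj₂ refl) _    = refl

  module Against (r : ℕ → Vertex G) where
    module H = Play G (seeHyperopic G) hyperopicStrategy r
    module C = Play G (seeClassical G) σ r

    history : ℕ → List (Event G d)
    history t = proj₂ (H.run t)

    Visible : ℕ → Set
    Visible t = seeHyperopic G (H.cops t) (r t) ≡ just (r t)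

    Invisible : ℕ → Set
    Invisible t = seeHyperopic G (H.cops t) (r t) ≡ nothing × CommonNeighbour G (H.cops t) (r t)

    VisibleBefore : ℕ → Set
    VisibleBefore t = ∀ t′ → t′ < t → Visible t′

    visible-or-invisible : ∀ t → Visible t ⊎ Invisible t
    visible-or-invisible t = swap (seeHyperopic-cases G (H.cops t) (r t))

    visibleBefore-≤ : ∀ {t u} → t ≤ u → VisibleBefore u → VisibleBefore t
    visibleBefore-≤ t≤u visible t′ t′<t = visible t′ (<-≤-trans t′<t t≤u)

    history-head : ∀ t → ∃ λ h → history t ≡ (H.cops t , seeHyperopic G (H.cops t) (r t)) ∷ h
    history-head zero    = _ , refl
    history-head (suc t) = _ , refl

    next-cops-visible : ∀ t → Visible t → H.cops (suc t) ≡ move (toClassical (history t))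
    next-cops-visible t visible with history-head t
    ... | h , eq rewrite eq | visible = refl

    next-cops-invisible : ∀ t → Invisible t → H.cops (suc t) ≡ surround G (H.cops t)
    next-cops-invisible t (hidden , _) with history-head t
    ... | h , eq rewrite eq | hidden = refl

    observation-history : ∀ t → Visible t → observation (history t) ≡ just (r t)
    observation-history t visible with history-head t
    ... | h , eq rewrite eq = visible

    mutual
      cops-agree : ∀ t → VisibleBefore t → H.cops t ≡ C.cops t
      cops-agree zero    _       = refl
      cops-agree (suc t) visible =
        trans (next-cops-visible t (visible t ≤-refl)) (cong move (history-agrees t visible))

      history-agrees : ∀ t → VisibleBefore (suc t) → toClassical (history t) ≡ proj₂ (C.run t)
      history-agrees zero    visible = toClassical-seen (visible zero ≤-refl)
      history-agrees (suc t) visible = begin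
        toClassical (history (suc t))
          ≡⟨ toClassical-seen (visible (suc t) ≤-refl) ⟩
        (c′ , just (r (suc t))) ∷ toClassical ((c′ , seeHyperopic G c′ (r t)) ∷ history t)
          ≡⟨ cong ((c′ , just (r (suc t))) ∷_)
                  (toClassical-unmoved (map₁ proj₁ (seeHyperopic-cases G c′ (r t)))
                                       (observation-history t (visible t (n≤1+n _)))) ⟩
        (c′ , just (r (suc t))) ∷ (c′ , just (r t)) ∷ toClassical (history t)
          ≡⟨ cong₂ (λ c h → (c , just (r (suc t))) ∷ (c , just (r t)) ∷ h)
                   (cops-agree (suc t) earlier) (history-agrees t earlier) ⟩
        proj₂ (C.run (suc t)) ∎
        where
          c′ = H.cops (suc t)
          earlier = visibleBefore-≤ (n≤1+n _) visible

    legal-agrees : ∀ t → VisibleBefore (suc t) → C.LegalStep t → H.LegalStep t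
    legal-agrees t visible =
      subst₂ (λ a b → ∀ i → Move G (a i) (b i))
        (sym (cops-agree t (visibleBefore-≤ (n≤1+n t) visible))) (sym (cops-agree (suc t) visible))

    legal-before : ∀ {t₀ T} → t₀ ≤ T → VisibleBefore t₀ →
      (∀ t → t < T → C.LegalStep t) → ∀ t → t < t₀ → H.LegalStep t
    legal-before t₀≤T visible legal t t<t₀ =
      legal-agrees t (visibleBefore-≤ t<t₀ visible) (legal t (<-≤-trans t<t₀ t₀≤T))

    capture-while-visible : ∀ {T} → VisibleBefore (suc T) → C.LonelyCaptureAt T → H.CaptureAt T
    capture-while-visible {T} visible (legal , _ , caught) =
      legal-before ≤-refl earlier legal , transfer caught
      where
        earlier = visibleBefore-≤ (n≤1+n T) visible
        transfer : (∃ λ i → C.cops T i ≡ r T) ⊎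
                   (C.LegalStep T × C.Lonely (suc T) × ∃ λ i → C.cops (suc T) i ≡ r T) →
                   (∃ λ i → H.cops T i ≡ r T) ⊎ (H.LegalStep T × ∃ λ i → H.cops (suc T) i ≡ r T)
        transfer (inj₁ (i , e)) = inj₁ (i , trans (cong-app (cops-agree T earlier) i) e)
        transfer (inj₂ (step , _ , i , e)) =
          inj₂ (legal-agrees T visible step , i , trans (cong-app (cops-agree (suc T) visible) i) e)

    capture-when-invisible : ∀ {T t₀} → t₀ ≤ T → VisibleBefore t₀ → Invisible t₀ →
      ¬ ContainsKab G d (suc d) → C.LonelyCaptureAt T → H.CaptureAt t₀
    capture-when-invisible {t₀ = t₀} t₀≤T visible invisible noK (legal , lonely , _) =
      legal-before t₀≤T visible legal , inj₂ (step , caught)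
      where
        surrounds = next-cops-invisible t₀ invisible
        step : H.LegalStep t₀
        step i = subst (λ c → Move G (H.cops t₀ i) (c i)) (sym surrounds)
                       (surround-legal G (H.cops t₀) i)
        distinct : Injective _≡_ _≡_ (H.cops t₀)
        distinct = subst (Injective _≡_ _≡_) (sym (cops-agree t₀ visible)) (lonely t₀ t₀≤T)
        caught : ∃ λ i → H.cops (suc t₀) i ≡ r t₀
        caught with surround-captures G distinct noK (proj₂ invisible)
        ... | i , e = i , trans (cong-app surrounds i) e

    captures : ¬ ContainsKab G d (suc d) → ∀ {T} → C.LonelyCaptureAt T → ∃ H.CaptureAt
    captures noK {T} capture with all-before-or-first-failure visible-or-invisible (suc T)
    ... | inj₁ visible = T , capture-while-visible visible capture
    ... | inj₂ (t₀ , t₀<1+T , visible , invisible) =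
      t₀ , capture-when-invisible (≤-pred t₀<1+T) visible invisible noK capture

open Simulation

mainTheorem14 : (G : Graph) → Connected G → (d : ℕ) → d ≥ 1 →
    ¬ ContainsKab G d (suc d) → HasLonelyClassicalWin G d →
    HyperopicCopNumber≤ G d
mainTheorem14 G _ d _ noK (σ , σ-wins) = d , ≤-refl , hyperopicStrategy G σ , wins
  where
    wins : Winning G (seeHyperopic G) (hyperopicStrategy G σ)
    wins r walk = Against.captures G σ r noK (proj₂ (σ-wins r walk))
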